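{- Let $n\ge 1$ and $k\ge 1$ be integers and let $C$ be an $(n,k)$ circuit code of length $N\ge 2(k+1)$. Then there exists an $(n+r,k+1)$ circuit code $C'$ of length $N'=N+2\left\lceil \frac{N}{2(k+1)}\right\rceil$, where $r=\left\lceil \log_2 \frac{N}{2(k+1)}\right\rceil+1$.
   Context: $I(n)$ denotes the graph of the $n$-dimensional hypercube: vertices are binary vectors of length $n$, two vertices adjacent iff they differ in exactly one coordinate. For an induced subgraph $G$ of $I(n)$ and vertices $x,x'$ of $G$, $d_G(x,x')$ is the number of edges of a shortest path from $x$ to $x'$ in $G$ ($\infty$ if none); $d_{I(n)}(x,x')$ is the Hamming distance. An induced subgraph $C$ of $I(n)$ is an $(n,k)$ circuit code (circuit code of spread $k$) if $C$ is a cycle and for all vertices $x,x'$ of $C$ with $d_{I(n)}(x,x')<k$ we have $d_C(x,x')=d_{I(n)}(x,x')$. The length of a circuit code is its number of vertices (equivalently edges). -}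

module Defs where

open import Data.Nat using (ℕ; zero; suc; _+_; _*_; _∸_; _^_; _≤_; _<_; ∣_-_∣; _⊓_)
open import Data.Nat.DivMod using (_/_)
open import Data.Bool using (Bool; true; false; _xor_)
open import Data.Vec using (Vec; []; _∷_)
open import Data.Fin using (Fin; toℕ)
open import Data.Product using (_×_)
open import Relation.Binary.PropositionalEquality using (_≡_)

Vertex : ℕ → Set
Vertex n = Vec Bool n

hamming : ∀ {n} → Vertex n → Vertex n → ℕ
hamming [] [] = 0
hamming (x ∷ xs) (y ∷ ys) = (if-diff x y) + hamming xs ys
  where
  if-diff : Bool → Bool → ℕ
  if-diff true  false = 1
  if-diff false true  = 1
  if-diff _     _     = 0

cycDist : (N : ℕ) → Fin N → Fin N → ℕ
cycDist N i j = ∣ toℕ i - toℕ j ∣ ⊓ (N ∸ ∣ toℕ i - toℕ j ∣)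

-- c : Fin N → Vertex n lists the vertices of a cycle in cyclic order.
IsInducedCycle : (n N : ℕ) → (Fin N → Vertex n) → Set
IsInducedCycle n N c =
  (3 ≤ N)
  × (∀ i j → c i ≡ c j → i ≡ j)
  × (∀ i j → hamming (c i) (c j) ≡ 1 → cycDist N i j ≡ 1)
  × (∀ i j → cycDist N i j ≡ 1 → hamming (c i) (c j) ≡ 1)

IsCircuitCode : (n k N : ℕ) → (Fin N → Vertex n) → Set
IsCircuitCode n k N c =
  IsInducedCycle n N c
  × (∀ i j → hamming (c i) (c j) < k → cycDist N i j ≡ hamming (c i) (c j))

-- ⌈ a / (b+1) ⌉
ceilDivSuc : ℕ → ℕ → ℕ
ceilDivSuc a b = (a + b) / suc b

-- r is ⌈ log₂ (a / b) ⌉ (for a ≥ b > 0): the least r with a ≤ 2^r * b.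
IsCeilLog2Ratio : ℕ → ℕ → ℕ → Set
IsCeilLog2Ratio a b r = (a ≤ 2 ^ r * b) × (∀ m → a ≤ 2 ^ m * b → r ≤ m)

module Submission where

open import Defs
open import Data.Bool using (Bool; true; false)
open import Data.Fin using (Fin; toℕ; fromℕ<)
open import Data.Fin.Properties using (toℕ<n; toℕ-fromℕ<; toℕ-injective)
open import Data.Nat
open import Data.Nat.DivMod
open import Data.Nat.Divisibility using (divides-refl)
open import Data.Nat.Properties
open import Data.Nat.Tactic.RingSolver using (solve-∀)
open import Data.Product using (Σ; ∃₂; _×_; _,_; proj₁; proj₂)
open import Data.Sum using (_⊎_; inj₁; inj₂; [_,_]′)
open import Data.Vec using ([]; _∷_; _++_)
open import Relation.Binary.Definitions using (tri<; tri≈; tri>)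
open import Relation.Binary.PropositionalEquality
open import Relation.Nullary using (Dec; yes; no)
open import Relation.Nullary.Negation using (contradiction)

-- Walk once around C, interleaving D = 2⌈N/(2k+2)⌉ steps in ρ + 1 fresh coordinates
-- that go once around a cycle of length D obtained from a reflected Gray code
-- (possible since D ≤ 2^(ρ+1)).  The fresh steps are spread evenly: between two
-- consecutive ones C advances by at most k + 1, and across three of them by at least k.
-- Two vertices of the new cycle at Hamming distance ≤ k are therefore either in the
-- same phase, where the cycle is locally a copy of C, or separated by one or two
-- fresh steps, each of which adds exactly one to both the Hamming distance and the
-- distance along the cycle; so the spread grows from k to k + 1.

hamming-refl : ∀ {n} (u : Vertex n) → hamming u u ≡ 0
hamming-refl []          = refl
hamming-refl (true ∷ u)  = hamming-refl u
hamming-refl (false ∷ u) = hamming-refl u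

≡⇒hamming≡0 : ∀ {n} {u v : Vertex n} → u ≡ v → hamming u v ≡ 0
≡⇒hamming≡0 {u = u} refl = hamming-refl u

hamming-sym : ∀ {n} (u v : Vertex n) → hamming u v ≡ hamming v u
hamming-sym []          []          = refl
hamming-sym (true ∷ u)  (true ∷ v)  = hamming-sym u v
hamming-sym (true ∷ u)  (false ∷ v) = cong suc (hamming-sym u v)
hamming-sym (false ∷ u) (true ∷ v)  = cong suc (hamming-sym u v)
hamming-sym (false ∷ u) (false ∷ v) = hamming-sym u v

hamming≡0⇒≡ : ∀ {n} (u v : Vertex n) → hamming u v ≡ 0 → u ≡ v
hamming≡0⇒≡ []          []          _ = refl
hamming≡0⇒≡ (true ∷ u)  (true ∷ v)  e = cong (true ∷_) (hamming≡0⇒≡ u v e)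
hamming≡0⇒≡ (false ∷ u) (false ∷ v) e = cong (false ∷_) (hamming≡0⇒≡ u v e)

hamming-triangle : ∀ {n} (u v w : Vertex n) → hamming u w ≤ hamming u v + hamming v w
hamming-triangle []          []          []          = z≤n
hamming-triangle (true ∷ u)  (true ∷ v)  (true ∷ w)  = hamming-triangle u v w
hamming-triangle (false ∷ u) (false ∷ v) (false ∷ w) = hamming-triangle u v w
hamming-triangle (true ∷ u)  (false ∷ v) (false ∷ w) = s≤s (hamming-triangle u v w)
hamming-triangle (false ∷ u) (true ∷ v)  (true ∷ w)  = s≤s (hamming-triangle u v w)
hamming-triangle (true ∷ u)  (true ∷ v)  (false ∷ w) =
  subst (suc (hamming u w) ≤_) (sym (+-suc _ _)) (s≤s (hamming-triangle u v w))
hamming-triangle (false ∷ u) (false ∷ v) (true ∷ w)  =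
  subst (suc (hamming u w) ≤_) (sym (+-suc _ _)) (s≤s (hamming-triangle u v w))
hamming-triangle (true ∷ u)  (false ∷ v) (true ∷ w)  =
  ≤-trans (hamming-triangle u v w) (+-mono-≤ (n≤1+n _) (n≤1+n _))
hamming-triangle (false ∷ u) (true ∷ v)  (false ∷ w) =
  ≤-trans (hamming-triangle u v w) (+-mono-≤ (n≤1+n _) (n≤1+n _))

hamming-++ : ∀ {n m} (u v : Vertex n) (u′ v′ : Vertex m) →
             hamming (u ++ u′) (v ++ v′) ≡ hamming u v + hamming u′ v′
hamming-++ []          []          u′ v′ = refl
hamming-++ (true ∷ u)  (true ∷ v)  u′ v′ = hamming-++ u v u′ v′
hamming-++ (true ∷ u)  (false ∷ v) u′ v′ = cong suc (hamming-++ u v u′ v′)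
hamming-++ (false ∷ u) (true ∷ v)  u′ v′ = cong suc (hamming-++ u v u′ v′)
hamming-++ (false ∷ u) (false ∷ v) u′ v′ = hamming-++ u v u′ v′

hamming-neighbour : ∀ {n} (u v w : Vertex n) → hamming u v ≡ 1 →
                    hamming u w ≡ suc (hamming v w) ⊎ suc (hamming u w) ≡ hamming v w
hamming-neighbour []          []          []          ()
hamming-neighbour (true ∷ u)  (true ∷ v)  (true ∷ w)  e = hamming-neighbour u v w e
hamming-neighbour (false ∷ u) (false ∷ v) (false ∷ w) e = hamming-neighbour u v w e
hamming-neighbour (true ∷ u)  (true ∷ v)  (false ∷ w) e with hamming-neighbour u v w e
... | inj₁ p = inj₁ (cong suc p)
... | inj₂ p = inj₂ (cong suc p)
hamming-neighbour (false ∷ u) (false ∷ v) (true ∷ w)  e with hamming-neighbour u v w e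
... | inj₁ p = inj₁ (cong suc p)
... | inj₂ p = inj₂ (cong suc p)
hamming-neighbour (true ∷ u)  (false ∷ v) (true ∷ w)  e
  rewrite hamming≡0⇒≡ u v (suc-injective e) = inj₂ refl
hamming-neighbour (true ∷ u)  (false ∷ v) (false ∷ w) e
  rewrite hamming≡0⇒≡ u v (suc-injective e) = inj₁ refl
hamming-neighbour (false ∷ u) (true ∷ v)  (true ∷ w)  e
  rewrite hamming≡0⇒≡ u v (suc-injective e) = inj₁ refl
hamming-neighbour (false ∷ u) (true ∷ v)  (false ∷ w) e
  rewrite hamming≡0⇒≡ u v (suc-injective e) = inj₂ refl

hamming-two-steps : ∀ {n} (u v w : Vertex n) → hamming u v ≡ 1 → hamming v w ≡ 1 →
                    1 ≤ hamming u w → hamming u w ≡ 2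
hamming-two-steps u v w uv vw 1≤uw with hamming-neighbour u v w uv
... | inj₁ e = trans e (cong suc vw)
... | inj₂ e = contradiction (suc-injective (trans e vw)) (m<n⇒n≢0 1≤uw)

hamming-walk : ∀ {n} (f : ℕ → Vertex n) → (∀ x → hamming (f x) (f (suc x)) ≡ 1) →
               ∀ d x → hamming (f x) (f (d + x)) ≤ d
hamming-walk f step zero    x = ≤-reflexive (hamming-refl (f x))
hamming-walk f step (suc d) x = begin
  hamming (f x) (f (suc d + x))                                     ≤⟨ hamming-triangle (f x) (f (d + x)) _ ⟩
  hamming (f x) (f (d + x)) + hamming (f (d + x)) (f (suc (d + x))) ≡⟨ cong (hamming (f x) (f (d + x)) +_) (step (d + x)) ⟩
  hamming (f x) (f (d + x)) + 1                                     ≤⟨ +-monoˡ-≤ 1 (hamming-walk f step d x) ⟩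
  d + 1                                                             ≡⟨ +-comm d 1 ⟩
  suc d                                                             ∎
  where open ≤-Reasoning

[m+kn]/n≡m/n+k : ∀ m k n .{{_ : NonZero n}} → (m + k * n) / n ≡ m / n + k
[m+kn]/n≡m/n+k m k n = trans (+-distrib-/-∣ʳ m (divides-refl k)) (cong (m / n +_) (m*n/n≡m k n))

cycDist-sym : ∀ L (i j : Fin L) → cycDist L i j ≡ cycDist L j i
cycDist-sym L i j = cong (λ d → d ⊓ (L ∸ d)) (∣-∣-comm (toℕ i) (toℕ j))

cycDist-self : ∀ L (i : Fin L) → cycDist L i i ≡ 0
cycDist-self L i = cong (λ d → d ⊓ (L ∸ d)) (∣n-n∣≡0 (toℕ i))

cycDist≡0⇒≡ : ∀ L (i j : Fin L) → cycDist L i j ≡ 0 → i ≡ j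
cycDist≡0⇒≡ L i j e with ⊓-sel ∣ toℕ i - toℕ j ∣ (L ∸ ∣ toℕ i - toℕ j ∣)
... | inj₁ min≡d   = toℕ-injective (∣m-n∣≡0⇒m≡n (trans (sym min≡d) e))
... | inj₂ min≡L∸d = contradiction (m∸n≡0⇒m≤n (trans (sym min≡L∸d) e))
                       (<⇒≱ (≤-<-trans (∣m-n∣≤m⊔n (toℕ i) (toℕ j)) (⊔-lub (toℕ<n i) (toℕ<n j))))

∣residue-difference∣ : ∀ N .{{_ : NonZero N}} x α → α ≤ N →
  ∣ x % N - (α + x) % N ∣ ≡ α ⊎ ∣ x % N - (α + x) % N ∣ ≡ N ∸ α
∣residue-difference∣ N x α α≤N =
  subst (λ y → ∣ r - y ∣ ≡ α ⊎ ∣ r - y ∣ ≡ N ∸ α) (sym [α+x]%N≡[α+r]%N) (by-overflow (α + r <? N))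
  where
  r = x % N
  [α+x]%N≡[α+r]%N : (α + x) % N ≡ (α + r) % N
  [α+x]%N≡[α+r]%N = trans (cong (λ y → (α + y) % N) (m≡m%n+[m/n]*n x N))
                          (trans (cong (_% N) (sym (+-assoc α r _))) ([m+kn]%n≡m%n (α + r) (x / N) N))
  by-overflow : Dec (α + r < N) → ∣ r - (α + r) % N ∣ ≡ α ⊎ ∣ r - (α + r) % N ∣ ≡ N ∸ α
  by-overflow (yes α+r<N) = inj₁ (begin
    ∣ r - (α + r) % N ∣ ≡⟨ cong (∣ r -_∣) (m<n⇒m%n≡m α+r<N) ⟩
    ∣ r - α + r ∣       ≡⟨ m≤n⇒∣m-n∣≡n∸m (m≤n+m r α) ⟩
    α + r ∸ r           ≡⟨ m+n∸n≡m α r ⟩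
    α                   ∎)
    where open ≡-Reasoning
  by-overflow (no α+r≮N) = inj₂ (begin
    ∣ r - (α + r) % N ∣ ≡⟨ cong (∣ r -_∣) [α+r]%N≡s ⟩
    ∣ r - s ∣           ≡⟨ m≤n⇒∣n-m∣≡n∸m s≤r ⟩
    r ∸ s               ≡⟨ cong (_∸ s) s+[N∸α]≡r ⟨
    s + (N ∸ α) ∸ s     ≡⟨ m+n∸m≡n s (N ∸ α) ⟩
    N ∸ α               ∎)
    where
    open ≡-Reasoning
    s = α + r ∸ N
    s+N≡α+r : s + N ≡ α + r
    s+N≡α+r = m∸n+n≡m (≮⇒≥ α+r≮N)
    [α+r]%N≡s : (α + r) % N ≡ s
    [α+r]%N≡s = trans (cong (_% N) (sym s+N≡α+r)) (trans ([m+n]%n≡m%n s N)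
      (m<n⇒m%n≡m (+-cancelʳ-< N s N (subst (_< N + N) (sym s+N≡α+r) (+-mono-≤-< α≤N (m%n<n x N))))))
    s+[N∸α]≡r : s + (N ∸ α) ≡ r
    s+[N∸α]≡r = +-cancelˡ-≡ α _ _ (begin
      α + (s + (N ∸ α)) ≡⟨ +-assoc α s _ ⟨
      α + s + (N ∸ α)   ≡⟨ cong (_+ (N ∸ α)) (+-comm α s) ⟩
      s + α + (N ∸ α)   ≡⟨ +-assoc s α _ ⟩
      s + (α + (N ∸ α)) ≡⟨ cong (s +_) (m+[n∸m]≡n α≤N) ⟩
      s + N             ≡⟨ s+N≡α+r ⟩
      α + r             ∎)
    s≤r : s ≤ r
    s≤r = subst (s ≤_) s+[N∸α]≡r (m≤m+n s (N ∸ α))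

cycDist-residues : ∀ N .{{_ : NonZero N}} x α → α ≤ N →
  cycDist N (fromℕ< (m%n<n x N)) (fromℕ< (m%n<n (α + x) N)) ≡ α ⊓ (N ∸ α)
cycDist-residues N x α α≤N
  rewrite toℕ-fromℕ< (m%n<n x N) | toℕ-fromℕ< (m%n<n (α + x) N)
  with ∣residue-difference∣ N x α α≤N
... | inj₁ e = cong (λ d → d ⊓ (N ∸ d)) e
... | inj₂ e = begin
  ∣ x % N - (α + x) % N ∣ ⊓ (N ∸ ∣ x % N - (α + x) % N ∣) ≡⟨ cong (λ d → d ⊓ (N ∸ d)) e ⟩
  (N ∸ α) ⊓ (N ∸ (N ∸ α))                                 ≡⟨ cong ((N ∸ α) ⊓_) (m∸[m∸n]≡n α≤N) ⟩
  (N ∸ α) ⊓ α                                             ≡⟨ ⊓-comm (N ∸ α) α ⟩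
  α ⊓ (N ∸ α)                                             ∎
  where open ≡-Reasoning

mirror : ℕ → ℕ → ℕ
mirror P i = (P + P) ∸ suc i

mirror-< : ∀ P {i} → P ≤ i → i < P + P → mirror P i < P
mirror-< P {i} P≤i i<2P = +-cancelʳ-< (suc i) _ _ (begin-strict
  (P + P) ∸ suc i + suc i ≡⟨ m∸n+n≡m i<2P ⟩
  P + P                   <⟨ +-monoʳ-< P (s≤s P≤i) ⟩
  P + suc i               ∎)
  where open ≤-Reasoning

mirror-injective : ∀ P {i j} → i < P + P → j < P + P → mirror P i ≡ mirror P j → i ≡ j
mirror-injective P i<2P j<2P e = suc-injective (∸-cancelˡ-≡ i<2P j<2P e)

mirror-suc : ∀ P {i} → suc i < P + P → mirror P i ≡ suc (mirror P (suc i))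
mirror-suc P {i} lt = go (P + P) (suc i) lt
  where
  go : ∀ m n → suc n ≤ m → m ∸ n ≡ suc (m ∸ suc n)
  go (suc m) zero    _         = refl
  go (suc m) (suc n) (s≤s n<m) = go m n n<m

mirror-middle : ∀ P {i} → suc i ≡ P → mirror P (suc i) ≡ i
mirror-middle P {i} refl = m+n∸n≡m i (suc i)

hamming-∷-same : ∀ {n} b (u v : Vertex n) → hamming (b ∷ u) (b ∷ v) ≡ hamming u v
hamming-∷-same true  u v = refl
hamming-∷-same false u v = refl

hamming-∷ʳ-same : ∀ {n} b (u v : Vertex n) → hamming (u ++ b ∷ []) (v ++ b ∷ []) ≡ hamming u v
hamming-∷ʳ-same b u v = begin
  hamming (u ++ b ∷ []) (v ++ b ∷ [])     ≡⟨ hamming-++ u v _ _ ⟩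
  hamming u v + hamming (b ∷ []) (b ∷ []) ≡⟨ cong (hamming u v +_) (hamming-refl (b ∷ [])) ⟩
  hamming u v + 0                         ≡⟨ +-identityʳ _ ⟩
  hamming u v                             ∎
  where open ≡-Reasoning

hamming-∷ʳ-flip : ∀ {n} (u v : Vertex n) → hamming (u ++ false ∷ []) (v ++ true ∷ []) ≡ suc (hamming u v)
hamming-∷ʳ-flip u v = trans (hamming-++ u v _ _) (+-comm (hamming u v) 1)

-- One doubling step of the binary reflected Gray code: run through f on [0, P), then
-- back again, the two halves told apart by a tag bit.
module Reflection {n n′ : ℕ} (tag : Bool → Vertex n → Vertex n′)
  (tag-same : ∀ b u v → hamming (tag b u) (tag b v) ≡ hamming u v)
  (tag-flip : ∀ u v → hamming (tag false u) (tag true v) ≡ suc (hamming u v)) where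

  reflect : ℕ → (ℕ → Vertex n) → ℕ → Vertex n′
  reflect P f i with i <? P
  ... | yes _ = tag false (f i)
  ... | no  _ = tag true (f (mirror P i))

  private
    same-tag : ∀ b {u v} → tag b u ≡ tag b v → u ≡ v
    same-tag b e = hamming≡0⇒≡ _ _ (trans (sym (tag-same b _ _)) (≡⇒hamming≡0 e))

    flipped-tag≢0 : ∀ u v → hamming (tag false u) (tag true v) ≢ 0
    flipped-tag≢0 u v e = contradiction (trans (sym (tag-flip u v)) e) λ ()

  module _ (P : ℕ) (f : ℕ → Vertex n) where

    reflect-adjacent : (∀ i → suc i < P → hamming (f i) (f (suc i)) ≡ 1) →
                       ∀ i → suc i < P + P → hamming (reflect P f i) (reflect P f (suc i)) ≡ 1
    reflect-adjacent adj i lt with i <? P | suc i <? P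
    ... | yes _   | yes i+1<P = trans (tag-same false _ _) (adj i i+1<P)
    ... | no  i≮P | yes i+1<P = contradiction (<-trans (n<1+n i) i+1<P) i≮P
    ... | yes i<P | no  i+1≮P = begin
      hamming (tag false (f i)) (tag true (f (mirror P (suc i)))) ≡⟨ tag-flip _ _ ⟩
      suc (hamming (f i) (f (mirror P (suc i))))                  ≡⟨ cong (λ j → suc (hamming (f i) (f j))) mirror≡i ⟩
      suc (hamming (f i) (f i))                                    ≡⟨ cong suc (hamming-refl (f i)) ⟩
      1                                                            ∎
      where
      open ≡-Reasoning
      mirror≡i : mirror P (suc i) ≡ i
      mirror≡i = mirror-middle P (≤-antisym i<P (≮⇒≥ i+1≮P))
    ... | no  i≮P | no  _     = begin
      hamming (tag true (f (mirror P i))) (tag true (f j)) ≡⟨ tag-same true _ _ ⟩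
      hamming (f (mirror P i)) (f j)                       ≡⟨ cong (λ x → hamming (f x) (f j)) (mirror-suc P lt) ⟩
      hamming (f (suc j)) (f j)                            ≡⟨ hamming-sym (f (suc j)) (f j) ⟩
      hamming (f j) (f (suc j))                            ≡⟨ adj j j+1<P ⟩
      1                                                    ∎
      where
      open ≡-Reasoning
      j = mirror P (suc i)
      j+1<P : suc j < P
      j+1<P = subst (_< P) (mirror-suc P lt) (mirror-< P (≮⇒≥ i≮P) (<-trans (n<1+n i) lt))

    reflect-injective : (∀ i j → i < P → j < P → f i ≡ f j → i ≡ j) →
                        ∀ i j → i < P + P → j < P + P → reflect P f i ≡ reflect P f j → i ≡ j
    reflect-injective inj i j i<2P j<2P e with i <? P | j <? P
    ... | yes i<P | yes j<P = inj i j i<P j<P (same-tag false e)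
    ... | yes _   | no  _   = contradiction (≡⇒hamming≡0 e) (flipped-tag≢0 _ _)
    ... | no  _   | yes _   =
      contradiction (trans (hamming-sym (tag false _) (tag true _)) (≡⇒hamming≡0 e)) (flipped-tag≢0 _ _)
    ... | no  i≮P | no  j≮P = mirror-injective P i<2P j<2P
      (inj _ _ (mirror-< P (≮⇒≥ i≮P) i<2P) (mirror-< P (≮⇒≥ j≮P) j<2P) (same-tag true e))

    reflect-closes : 1 ≤ P → ∀ i → suc i ≡ P + P → hamming (reflect P f i) (reflect P f 0) ≡ 1
    reflect-closes 1≤P i i+1≡2P with i <? P | 0 <? P
    ... | yes i<P | _       = contradiction (subst (_≤ P) i+1≡2P i<P) (<⇒≱ (m<m+n P 1≤P))
    ... | no  _   | no  0≮P = contradiction 1≤P 0≮P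
    ... | no  _   | yes _   = begin
      hamming (tag true (f (mirror P i))) (tag false (f 0)) ≡⟨ hamming-sym (tag true (f (mirror P i))) (tag false (f 0)) ⟩
      hamming (tag false (f 0)) (tag true (f (mirror P i))) ≡⟨ tag-flip _ _ ⟩
      suc (hamming (f 0) (f (mirror P i)))                  ≡⟨ cong (λ x → suc (hamming (f 0) (f x))) mirror≡0 ⟩
      suc (hamming (f 0) (f 0))                             ≡⟨ cong suc (hamming-refl (f 0)) ⟩
      1                                                     ∎
      where
      open ≡-Reasoning
      mirror≡0 : mirror P i ≡ 0
      mirror≡0 = trans (cong ((P + P) ∸_) i+1≡2P) (n∸n≡0 (P + P))

module Prepend {n : ℕ} = Reflection {n} _∷_ hamming-∷-same (λ _ _ → refl)
module Append {n : ℕ} = Reflection {n} (λ b u → u ++ b ∷ []) hamming-∷ʳ-same hamming-∷ʳ-flip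

gray : (ρ : ℕ) → ℕ → Vertex ρ
gray zero    _ = []
gray (suc ρ)   = Prepend.reflect (2 ^ ρ) (gray ρ)

2^suc≡2^+2^ : ∀ ρ → 2 ^ suc ρ ≡ 2 ^ ρ + 2 ^ ρ
2^suc≡2^+2^ ρ = cong (2 ^ ρ +_) (+-identityʳ (2 ^ ρ))

gray-adjacent : ∀ ρ i → suc i < 2 ^ ρ → hamming (gray ρ i) (gray ρ (suc i)) ≡ 1
gray-adjacent zero    i (s≤s ())
gray-adjacent (suc ρ) i lt =
  Prepend.reflect-adjacent (2 ^ ρ) (gray ρ) (gray-adjacent ρ) i (subst (suc i <_) (2^suc≡2^+2^ ρ) lt)

gray-injective : ∀ ρ i j → i < 2 ^ ρ → j < 2 ^ ρ → gray ρ i ≡ gray ρ j → i ≡ j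
gray-injective zero    zero zero _ _ _ = refl
gray-injective zero    (suc _) _ (s≤s ()) _ _
gray-injective zero    _ (suc _) _ (s≤s ()) _
gray-injective (suc ρ) i    j    i< j< =
  Prepend.reflect-injective (2 ^ ρ) (gray ρ) (gray-injective ρ) i j
    (subst (i <_) (2^suc≡2^+2^ ρ) i<) (subst (j <_) (2^suc≡2^+2^ ρ) j<)

mod-adjacent : ∀ {n} D .{{_ : NonZero D}} (f : ℕ → Vertex n) →
               (∀ i → suc i < D → hamming (f i) (f (suc i)) ≡ 1) →
               (∀ i → suc i ≡ D → hamming (f i) (f 0) ≡ 1) →
               ∀ b → hamming (f (b % D)) (f (suc b % D)) ≡ 1
mod-adjacent D f adj closes b =
  subst (λ x → hamming (f r) (f x) ≡ 1) (sym [b+1]%D≡[r+1]%D) (from-residue (suc r <? D))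
  where
  r = b % D
  [b+1]%D≡[r+1]%D : suc b % D ≡ suc r % D
  [b+1]%D≡[r+1]%D = trans (cong (λ x → suc x % D) (m≡m%n+[m/n]*n b D)) ([m+kn]%n≡m%n (suc r) (b / D) D)
  from-residue : Dec (suc r < D) → hamming (f r) (f (suc r % D)) ≡ 1
  from-residue (yes r+1<D) = subst (λ x → hamming (f r) (f x) ≡ 1) (sym (m<n⇒m%n≡m r+1<D)) (adj r r+1<D)
  from-residue (no  r+1≮D) = subst (λ x → hamming (f r) (f x) ≡ 1) 0≡[r+1]%D (closes r r+1≡D)
    where
    r+1≡D : suc r ≡ D
    r+1≡D = ≤-antisym (m%n<n b D) (≮⇒≥ r+1≮D)
    0≡[r+1]%D : 0 ≡ suc r % D
    0≡[r+1]%D = trans (sym (n%n≡0 D)) (cong (_% D) (sym r+1≡D))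

module GrayCycle (ρ m : ℕ) (1≤m : 1 ≤ m) (m≤2^ρ : m ≤ 2 ^ ρ) where

  instance
    2m-nonZero : NonZero (2 * m)
    2m-nonZero = >-nonZero (≤-trans 1≤m (m≤m+n m _))

  2m≡m+m : 2 * m ≡ m + m
  2m≡m+m = cong (m +_) (+-identityʳ m)

  grayCycle : ℕ → Vertex (ρ + 1)
  grayCycle b = Append.reflect m (gray ρ) (b % (2 * m))

  grayCycle-periodic : ∀ b → grayCycle (b + 2 * m) ≡ grayCycle b
  grayCycle-periodic b = cong (Append.reflect m (gray ρ)) ([m+n]%n≡m%n b (2 * m))

  grayCycle-adjacent : ∀ b → hamming (grayCycle b) (grayCycle (suc b)) ≡ 1
  grayCycle-adjacent = mod-adjacent (2 * m) (Append.reflect m (gray ρ))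
    (λ i lt → Append.reflect-adjacent m (gray ρ)
                (λ j j+1<m → gray-adjacent ρ j (≤-trans j+1<m m≤2^ρ)) i (subst (suc i <_) 2m≡m+m lt))
    (λ i e → Append.reflect-closes m (gray ρ) 1≤m i (trans e 2m≡m+m))

  grayCycle-injective : ∀ i j → i < 2 * m → j < 2 * m → grayCycle i ≡ grayCycle j → i ≡ j
  grayCycle-injective i j i<2m j<2m e =
    Append.reflect-injective m (gray ρ)
      (λ i′ j′ i′<m j′<m → gray-injective ρ i′ j′ (≤-trans i′<m m≤2^ρ) (≤-trans j′<m m≤2^ρ))
      i j (subst (i <_) 2m≡m+m i<2m) (subst (j <_) 2m≡m+m j<2m)
      (subst₂ (λ x y → Append.reflect m (gray ρ) x ≡ Append.reflect m (gray ρ) y)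
              (m<n⇒m%n≡m i<2m) (m<n⇒m%n≡m j<2m) e)

module Unrolled {n k N : ℕ} (C : Fin N → Vertex n) (code : IsCircuitCode n k N C)
  (2[k+1]≤N : 2 * (k + 1) ≤ N) where

  [1+k]+[1+k]≤N : suc k + suc k ≤ N
  [1+k]+[1+k]≤N = subst (_≤ N) 2[k+1]≡[1+k]+[1+k] 2[k+1]≤N
    where
    2[k+1]≡[1+k]+[1+k] : 2 * (k + 1) ≡ suc k + suc k
    2[k+1]≡[1+k]+[1+k] = trans (cong (k + 1 +_) (+-identityʳ (k + 1))) (cong₂ _+_ (+-comm k 1) (+-comm k 1))

  instance
    N-nonZero : NonZero N
    N-nonZero = >-nonZero (≤-trans (s≤s z≤n) [1+k]+[1+k]≤N)

  walk : ℕ → Vertex n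
  walk x = C (fromℕ< (m%n<n x N))

  walk-periodic : ∀ x → walk (x + N) ≡ walk x
  walk-periodic x = cong C (toℕ-injective (begin
    toℕ (fromℕ< (m%n<n (x + N) N)) ≡⟨ toℕ-fromℕ< _ ⟩
    (x + N) % N                    ≡⟨ [m+n]%n≡m%n x N ⟩
    x % N                          ≡⟨ toℕ-fromℕ< _ ⟨
    toℕ (fromℕ< (m%n<n x N))       ∎))
    where open ≡-Reasoning

  short-arc : ∀ {α} → α ≤ suc k → α ⊓ (N ∸ α) ≡ α
  short-arc {α} α≤1+k = m≤n⇒m⊓n≡m (m+n≤o⇒m≤o∸n α (≤-trans (+-mono-≤ α≤1+k α≤1+k) [1+k]+[1+k]≤N))

  short-arc≤N : ∀ {α} → α ≤ suc k → α ≤ N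
  short-arc≤N α≤1+k = ≤-trans α≤1+k (m+n≤o⇒m≤o (suc k) [1+k]+[1+k]≤N)

  walk-adjacent : ∀ x → hamming (walk x) (walk (suc x)) ≡ 1
  walk-adjacent x = proj₂ (proj₂ (proj₂ (proj₁ code))) _ _
    (trans (cycDist-residues N x 1 (short-arc≤N (s≤s z≤n))) (short-arc (s≤s z≤n)))

  walk-spread : ∀ x α → α ≤ N → hamming (walk x) (walk (α + x)) < k →
                α ⊓ (N ∸ α) ≡ hamming (walk x) (walk (α + x))
  walk-spread x α α≤N h<k = trans (sym (cycDist-residues N x α α≤N)) (proj₂ code _ _ h<k)

  walk-arc≤k : ∀ x α → α ≤ k → hamming (walk x) (walk (α + x)) ≡ α
  walk-arc≤k x α α≤k with hamming (walk x) (walk (α + x)) <? k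
  ... | yes h<k = trans (sym (walk-spread x α (short-arc≤N α≤1+k) h<k)) (short-arc α≤1+k)
    where α≤1+k = m≤n⇒m≤1+n α≤k
  ... | no  h≮k = ≤-antisym (hamming-walk walk walk-adjacent α x) (≤-trans α≤k (≮⇒≥ h≮k))

  walk-arc-1+k : ∀ x → hamming (walk x) (walk (suc k + x)) ≡ suc k
  walk-arc-1+k x = from-neighbour (hamming-neighbour (walk x) (walk (suc x)) (walk (suc k + x)) (walk-adjacent x))
    where
    h = hamming (walk x) (walk (suc k + x))
    h′≡k : hamming (walk (suc x)) (walk (suc k + x)) ≡ k
    h′≡k = trans (cong (λ y → hamming (walk (suc x)) (walk y)) (sym (+-suc k x))) (walk-arc≤k (suc x) k ≤-refl)
    from-neighbour : h ≡ suc (hamming (walk (suc x)) (walk (suc k + x)))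
                   ⊎ suc h ≡ hamming (walk (suc x)) (walk (suc k + x)) → h ≡ suc k
    from-neighbour (inj₁ e) = trans e (cong suc h′≡k)
    from-neighbour (inj₂ e) = contradiction h<k (<-asym (subst (k <_) 1+k≡h (n<1+n k)))
      where
      h<k : h < k
      h<k = ≤-reflexive (trans e h′≡k)
      1+k≡h : suc k ≡ h
      1+k≡h = trans (sym (short-arc ≤-refl)) (walk-spread x (suc k) (short-arc≤N ≤-refl) h<k)

  walk-arc : ∀ x α → α ≤ suc k → hamming (walk x) (walk (α + x)) ≡ α
  walk-arc x α α≤1+k with m≤n⇒m<n∨m≡n α≤1+k
  ... | inj₁ α<1+k = walk-arc≤k x α (≤-pred α<1+k)
  ... | inj₂ refl  = walk-arc-1+k x

-- In state (a , b), a steps of C and b fresh steps have been taken; the b-th fresh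
-- step is taken as soon as a reaches threshold b = ⌊(b + 1)N/D⌋.
module Schedule (N D k : ℕ) .{{_ : NonZero D}}
  (N≤[1+k]D : N ≤ suc k * D) (kD≤2N : k * D ≤ N + N) where

  threshold : ℕ → ℕ
  threshold b = (suc b * N) / D

  threshold-mono : ∀ {b b′} → b ≤ b′ → threshold b ≤ threshold b′
  threshold-mono b≤b′ = /-monoˡ-≤ D (*-monoˡ-≤ N (s≤s b≤b′))

  threshold-0 : threshold 0 ≤ suc k
  threshold-0 = begin
    (1 * N) / D       ≡⟨ cong (_/ D) (*-identityˡ N) ⟩
    N / D             ≤⟨ /-monoˡ-≤ D N≤[1+k]D ⟩
    (suc k * D) / D   ≡⟨ m*n/n≡m (suc k) D ⟩
    suc k             ∎
    where open ≤-Reasoning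

  threshold-suc : ∀ b → threshold (suc b) ≤ threshold b + suc k
  threshold-suc b = begin
    (N + suc b * N) / D       ≡⟨ cong (_/ D) (+-comm N (suc b * N)) ⟩
    (suc b * N + N) / D       ≤⟨ /-monoˡ-≤ D (+-monoʳ-≤ (suc b * N) N≤[1+k]D) ⟩
    (suc b * N + suc k * D) / D ≡⟨ [m+kn]/n≡m/n+k (suc b * N) (suc k) D ⟩
    threshold b + suc k       ∎
    where open ≤-Reasoning

  threshold-2+ : ∀ b → threshold b + k ≤ threshold (2 + b)
  threshold-2+ b = begin
    threshold b + k           ≡⟨ [m+kn]/n≡m/n+k (suc b * N) k D ⟨
    (suc b * N + k * D) / D   ≤⟨ /-monoˡ-≤ D (+-monoʳ-≤ (suc b * N) kD≤2N) ⟩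
    (suc b * N + (N + N)) / D ≡⟨ cong (_/ D) (trans (+-comm (suc b * N) (N + N)) (+-assoc N N (suc b * N))) ⟩
    threshold (2 + b)         ∎
    where open ≤-Reasoning

  threshold-last : threshold (pred D) ≡ N
  threshold-last = begin
    (suc (pred D) * N) / D ≡⟨ cong (λ x → (x * N) / D) (suc-pred D) ⟩
    (D * N) / D            ≡⟨ cong (_/ D) (*-comm D N) ⟩
    (N * D) / D            ≡⟨ m*n/n≡m N D ⟩
    N                      ∎
    where open ≡-Reasoning

  threshold-periodic : ∀ b → threshold (b + D) ≡ threshold b + N
  threshold-periodic b = begin
    (suc (b + D) * N) / D    ≡⟨ cong (_/ D) (*-distribʳ-+ N (suc b) D) ⟩
    (suc b * N + D * N) / D  ≡⟨ cong (λ x → (suc b * N + x) / D) (*-comm D N) ⟩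
    (suc b * N + N * D) / D  ≡⟨ [m+kn]/n≡m/n+k (suc b * N) N D ⟩
    threshold b + N          ∎
    where open ≡-Reasoning

  entry : ℕ → ℕ
  entry zero    = 0
  entry (suc b) = threshold b

  threshold≤entry+1+k : ∀ b → threshold b ≤ suc k + entry b
  threshold≤entry+1+k zero    = subst (threshold 0 ≤_) (sym (+-identityʳ (suc k))) threshold-0
  threshold≤entry+1+k (suc b) = subst (threshold (suc b) ≤_) (+-comm (threshold b) (suc k)) (threshold-suc b)

  step : ℕ × ℕ → ℕ × ℕ
  step (a , b) with a <? threshold b
  ... | yes _ = (suc a , b)
  ... | no  _ = (a , suc b)

  state : ℕ → ℕ × ℕ
  state zero    = (0 , 0)
  state (suc p) = step (state p)

  pos : ℕ → ℕ
  pos p = proj₁ (state p)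

  phase : ℕ → ℕ
  phase p = proj₂ (state p)

  data Step : ℕ × ℕ → ℕ × ℕ → Set where
    advance : ∀ {a b} → a < threshold b → Step (a , b) (suc a , b)
    switch  : ∀ {a b} → threshold b ≤ a → Step (a , b) (a , suc b)

  step-Step : ∀ s → Step s (step s)
  step-Step (a , b) with a <? threshold b
  ... | yes a<t = advance a<t
  ... | no  a≮t = switch (≮⇒≥ a≮t)

  Bounded : ℕ × ℕ → Set
  Bounded (a , b) = entry b ≤ a × a ≤ threshold b

  Step-Bounded : ∀ {s s′} → Step s s′ → Bounded s → Bounded s′
  Step-Bounded (advance a<t) (e≤a , _)   = ≤-trans e≤a (n≤1+n _) , a<t
  Step-Bounded (switch {b = b} t≤a) (_ , a≤t) = t≤a , ≤-trans a≤t (threshold-mono (n≤1+n b))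

  bounded : ∀ p → Bounded (state p)
  bounded zero    = z≤n , z≤n
  bounded (suc p) = Step-Bounded (step-Step (state p)) (bounded p)

  entry≤pos : ∀ p → entry (phase p) ≤ pos p
  entry≤pos p = proj₁ (bounded p)

  pos≤threshold : ∀ p → pos p ≤ threshold (phase p)
  pos≤threshold p = proj₂ (bounded p)

  Moves : ℕ × ℕ → ℕ × ℕ → Set
  Moves s s′ = (proj₁ s′ ≡ suc (proj₁ s) × proj₂ s′ ≡ proj₂ s)
             ⊎ (proj₁ s′ ≡ proj₁ s × proj₂ s′ ≡ suc (proj₂ s))

  Step-Moves : ∀ {s s′} → Step s s′ → Moves s s′
  Step-Moves (advance _) = inj₁ (refl , refl)
  Step-Moves (switch  _) = inj₂ (refl , refl)

  steps-split : ∀ d x → ∃₂ λ α t →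
                pos (d + x) ≡ α + pos x × phase (d + x) ≡ t + phase x × d ≡ α + t
  steps-split zero    x = 0 , 0 , refl , refl , refl
  steps-split (suc d) x with steps-split d x | Step-Moves (step-Step (state (d + x)))
  ... | α , t , eA , eP , ed | inj₁ (a′ , b′) =
    suc α , t , trans a′ (cong suc eA) , trans b′ eP , cong suc ed
  ... | α , t , eA , eP , ed | inj₂ (a′ , b′) =
    α , suc t , trans a′ eA , trans b′ (cong suc eP) , trans (cong suc ed) (sym (+-suc α t))

  pos+phase : ∀ p → pos p + phase p ≡ p
  pos+phase zero = refl
  pos+phase (suc p) with Step-Moves (step-Step (state p))
  ... | inj₁ (a′ , b′) = trans (cong₂ _+_ a′ b′) (cong suc (pos+phase p))
  ... | inj₂ (a′ , b′) = trans (cong₂ _+_ a′ b′) (trans (+-suc _ _) (cong suc (pos+phase p)))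

  pos-same-phase : ∀ x y → phase x ≡ phase y → pos y ≤ suc k + pos x
  pos-same-phase x y e = begin
    pos y                    ≤⟨ pos≤threshold y ⟩
    threshold (phase y)      ≡⟨ cong threshold e ⟨
    threshold (phase x)      ≤⟨ threshold≤entry+1+k (phase x) ⟩
    suc k + entry (phase x)  ≤⟨ +-monoʳ-≤ (suc k) (entry≤pos x) ⟩
    suc k + pos x            ∎
    where open ≤-Reasoning

  pos-three-phases : ∀ x y → 3 + phase x ≤ phase y → k + pos x ≤ pos y
  pos-three-phases x y le with phase y | entry≤pos y
  ... | suc b | entry≤posy = begin
    k + pos x               ≤⟨ +-monoʳ-≤ k (pos≤threshold x) ⟩
    k + threshold (phase x) ≡⟨ +-comm k _ ⟩
    threshold (phase x) + k ≤⟨ threshold-2+ (phase x) ⟩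
    threshold (2 + phase x) ≤⟨ threshold-mono (≤-pred le) ⟩
    threshold b             ≤⟨ entry≤posy ⟩
    pos y                   ∎
    where open ≤-Reasoning

  shift : ℕ × ℕ → ℕ × ℕ
  shift (a , b) = (a + N , b + D)

  step-shift : ∀ s → step (shift s) ≡ shift (step s)
  step-shift (a , b) with a + N <? threshold (b + D) | a <? threshold b
  ... | yes _   | yes _   = refl
  ... | no  _   | no  _   = refl
  ... | yes lt  | no  a≮t = contradiction (+-cancelʳ-< N a _ (subst (a + N <_) (threshold-periodic b) lt)) a≮t
  ... | no  a≮t | yes lt  = contradiction (subst (a + N <_) (sym (threshold-periodic b)) (+-monoˡ-< N lt)) a≮t

  N≤entry : ∀ b → D < b → N ≤ entry b
  N≤entry (suc b) (s≤s D≤b) = begin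
    N                  ≤⟨ m≤n+m N (threshold 0) ⟩
    threshold 0 + N    ≡⟨ threshold-periodic 0 ⟨
    threshold (0 + D)  ≤⟨ threshold-mono D≤b ⟩
    threshold b        ∎
    where open ≤-Reasoning

  state-period : state (N + D) ≡ (N , D)
  state-period with state (N + D) | bounded (N + D) | pos+phase (N + D)
  ... | a , b | e≤a , a≤t | a+b≡N+D with <-cmp b D
  ... | tri≈ _ b≡D _ rewrite b≡D = cong (_, D) (+-cancelʳ-≡ D a N a+b≡N+D)
  ... | tri< b<D _ _ = contradiction a+b≡N+D (<⇒≢ (+-mono-≤-< a≤N b<D))
    where
    a≤N : a ≤ N
    a≤N = ≤-trans a≤t (≤-trans (threshold-mono (<⇒≤pred b<D)) (≤-reflexive threshold-last))
  ... | tri> _ _ D<b = contradiction (sym a+b≡N+D) (<⇒≢ (+-mono-≤-< (≤-trans (N≤entry b D<b) e≤a) D<b))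

  state-periodic : ∀ p → state (p + (N + D)) ≡ shift (state p)
  state-periodic zero    = state-period
  state-periodic (suc p) = trans (cong step (state-periodic p)) (step-shift (state p))

  pos-periodic : ∀ p → pos (p + (N + D)) ≡ pos p + N
  pos-periodic p = cong proj₁ (state-periodic p)

  phase-periodic : ∀ p → phase (p + (N + D)) ≡ phase p + D
  phase-periodic p = cong proj₂ (state-periodic p)

  phase<D : ∀ p → p < N + D → phase p < D
  phase<D p p<N+D with steps-split (N + D ∸ p) p
  ... | α , t , _ , eP , _ = ≤∧≢⇒< phase≤D phase≢D
    where
    phase≤D : phase p ≤ D
    phase≤D = begin
      phase p                 ≤⟨ m≤n+m (phase p) t ⟩
      t + phase p             ≡⟨ eP ⟨
      phase (N + D ∸ p + p)   ≡⟨ cong phase (m∸n+n≡m (<⇒≤ p<N+D)) ⟩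
      phase (N + D)           ≡⟨ cong proj₂ state-period ⟩
      D                       ∎
      where open ≤-Reasoning
    phase≢D : phase p ≢ D
    phase≢D e = <⇒≱ p<N+D (begin
      N + D                     ≡⟨ cong (_+ D) threshold-last ⟨
      threshold (pred D) + D    ≡⟨ cong₂ _+_ (cong entry (sym (trans e (sym (suc-pred D))))) (sym e) ⟩
      entry (phase p) + phase p ≤⟨ +-monoˡ-≤ (phase p) (entry≤pos p) ⟩
      pos p + phase p           ≡⟨ pos+phase p ⟩
      p                         ∎)
      where open ≤-Reasoning

  pos-mono : ∀ d x → pos x ≤ pos (d + x)
  pos-mono d x with steps-split d x
  ... | α , _ , eA , _ , _ = subst (pos x ≤_) (sym eA) (m≤n+m (pos x) α)

symmetric-by-≤ : ∀ {L} (P : Fin L → Fin L → Set) → (∀ {i j} → P i j → P j i) →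
                 (∀ i j → toℕ i ≤ toℕ j → P i j) → ∀ i j → P i j
symmetric-by-≤ P sym-P P≤ i j with ≤-total (toℕ i) (toℕ j)
... | inj₁ i≤j = P≤ i j i≤j
... | inj₂ j≤i = sym-P (P≤ j i j≤i)

module PeriodicWalk {n L : ℕ} (F : ℕ → Vertex n)
  (F-periodic : ∀ p → F (p + L) ≡ F p)
  (F-adjacent : ∀ p → hamming (F p) (F (suc p)) ≡ 1) where

  cycle : Fin L → Vertex n
  cycle i = F (toℕ i)

  Isometric : ℕ → Set
  Isometric K = ∀ p d → d + p < L → hamming (F p) (F (d + p)) < K →
                d ≤ hamming (F p) (F (d + p)) ⊎ L ∸ d ≤ hamming (F p) (F (d + p))

  module Ordered (i j : Fin L) (i≤j : toℕ i ≤ toℕ j) where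
    p = toℕ i
    d = toℕ j ∸ toℕ i

    d+p≡j : d + p ≡ toℕ j
    d+p≡j = m∸n+n≡m i≤j

    d+p<L : d + p < L
    d+p<L = subst (_< L) (sym d+p≡j) (toℕ<n j)

    h≡ : hamming (cycle i) (cycle j) ≡ hamming (F p) (F (d + p))
    h≡ = cong (λ x → hamming (F p) (F x)) (sym d+p≡j)

    cycDist≡ : cycDist L i j ≡ d ⊓ (L ∸ d)
    cycDist≡ = cong (λ x → x ⊓ (L ∸ x)) (m≤n⇒∣m-n∣≡n∸m i≤j)

    h≤d : hamming (cycle i) (cycle j) ≤ d
    h≤d = subst (_≤ d) (sym h≡) (hamming-walk F F-adjacent d p)

    h≤L∸d : hamming (cycle i) (cycle j) ≤ L ∸ d
    h≤L∸d = subst (_≤ L ∸ d) (sym (trans h≡ (trans (hamming-sym (F p) _) h-back)))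
                  (hamming-walk F F-adjacent (L ∸ d) (d + p))
      where
      F[L∸d+d+p]≡Fp : F (L ∸ d + (d + p)) ≡ F p
      F[L∸d+d+p]≡Fp = begin
        F (L ∸ d + (d + p)) ≡⟨ cong F (+-assoc (L ∸ d) d p) ⟨
        F (L ∸ d + d + p)   ≡⟨ cong (λ x → F (x + p)) (m∸n+n≡m (≤-trans (m≤m+n d p) (<⇒≤ d+p<L))) ⟩
        F (L + p)           ≡⟨ cong F (+-comm L p) ⟩
        F (p + L)           ≡⟨ F-periodic p ⟩
        F p                 ∎
        where open ≡-Reasoning
      h-back : hamming (F (d + p)) (F p) ≡ hamming (F (d + p)) (F (L ∸ d + (d + p)))
      h-back = cong (hamming (F (d + p))) (sym F[L∸d+d+p]≡Fp)

  hamming≤cycDist : ∀ i j → hamming (cycle i) (cycle j) ≤ cycDist L i j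
  hamming≤cycDist = symmetric-by-≤ (λ i j → hamming (cycle i) (cycle j) ≤ cycDist L i j)
    (λ {i} {j} → subst₂ _≤_ (hamming-sym (cycle i) (cycle j)) (cycDist-sym L i j))
    (λ i j i≤j → let open Ordered i j i≤j in
                 subst (hamming (cycle i) (cycle j) ≤_) (sym cycDist≡) (⊓-glb h≤d h≤L∸d))

  spread : ∀ {K} → Isometric K → ∀ i j → hamming (cycle i) (cycle j) < K →
           cycDist L i j ≡ hamming (cycle i) (cycle j)
  spread {K} iso = symmetric-by-≤ Spread
    (λ {i} {j} → subst₂ (λ c h → h < K → c ≡ h) (cycDist-sym L i j) (hamming-sym (cycle i) (cycle j)))
    (λ i j i≤j h<K → ≤-antisym (cycDist≤h i j i≤j h<K) (hamming≤cycDist i j))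
    where
    Spread : Fin L → Fin L → Set
    Spread i j = hamming (cycle i) (cycle j) < K → cycDist L i j ≡ hamming (cycle i) (cycle j)
    cycDist≤h : ∀ i j → toℕ i ≤ toℕ j → hamming (cycle i) (cycle j) < K →
                cycDist L i j ≤ hamming (cycle i) (cycle j)
    cycDist≤h i j i≤j h<K = subst₂ _≤_ (sym cycDist≡) (sym h≡)
      ([ m≤n⇒m⊓o≤n (L ∸ d) , m≤n⇒o⊓m≤n d ]′ (iso p d d+p<L (subst (_< K) h≡ h<K)))
      where open Ordered i j i≤j

  isCircuitCode : ∀ {K} → 3 ≤ L → 2 ≤ K → Isometric K → IsCircuitCode n K L cycle
  isCircuitCode {K} 3≤L 2≤K iso = (3≤L , injective , adjacent⇒consecutive , consecutive⇒adjacent) , spread iso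
    where
    injective : ∀ i j → cycle i ≡ cycle j → i ≡ j
    injective i j e =
      cycDist≡0⇒≡ L i j (trans (spread iso i j (subst (_< K) (sym h≡0) (≤-trans (s≤s z≤n) 2≤K))) h≡0)
      where h≡0 = ≡⇒hamming≡0 e
    adjacent⇒consecutive : ∀ i j → hamming (cycle i) (cycle j) ≡ 1 → cycDist L i j ≡ 1
    adjacent⇒consecutive i j h≡1 = trans (spread iso i j (subst (_< K) (sym h≡1) 2≤K)) h≡1
    consecutive⇒adjacent : ∀ i j → cycDist L i j ≡ 1 → hamming (cycle i) (cycle j) ≡ 1
    consecutive⇒adjacent i j c≡1 = ≤-antisym (subst (hamming (cycle i) (cycle j) ≤_) c≡1 (hamming≤cycDist i j)) 1≤h
      where
      1≤h : 1 ≤ hamming (cycle i) (cycle j)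
      1≤h = n≢0⇒n>0 λ h≡0 → 0≢1+n (begin
        0              ≡⟨ cycDist-self L i ⟨
        cycDist L i i  ≡⟨ cong (cycDist L i) (injective i j (hamming≡0⇒≡ _ _ h≡0)) ⟩
        cycDist L i j  ≡⟨ c≡1 ⟩
        1              ∎)
        where open ≡-Reasoning

≤ceilDivSuc*suc : ∀ a b → a ≤ ceilDivSuc a b * suc b
≤ceilDivSuc*suc a b = +-cancelʳ-≤ b a _ (begin
  a + b                                   ≡⟨ m≡m%n+[m/n]*n (a + b) (suc b) ⟩
  (a + b) % suc b + ceilDivSuc a b * suc b ≤⟨ +-monoˡ-≤ _ (≤-pred (m%n<n (a + b) (suc b))) ⟩
  b + ceilDivSuc a b * suc b              ≡⟨ +-comm b _ ⟩
  ceilDivSuc a b * suc b + b              ∎)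
  where open ≤-Reasoning

ceilDivSuc*suc≤ : ∀ a b → ceilDivSuc a b * suc b ≤ a + b
ceilDivSuc*suc≤ a b = m/n*n≤m (a + b) (suc b)

ceilDivSuc-least : ∀ a b c → a ≤ c * suc b → ceilDivSuc a b ≤ c
ceilDivSuc-least a b c a≤cB = begin
  (a + b) / suc b           ≤⟨ /-monoˡ-≤ (suc b) (+-monoˡ-≤ b a≤cB) ⟩
  (c * suc b + b) / suc b   ≡⟨ cong (_/ suc b) (+-comm (c * suc b) b) ⟩
  (b + c * suc b) / suc b   ≡⟨ [m+kn]/n≡m/n+k b c (suc b) ⟩
  b / suc b + c             ≡⟨ cong (_+ c) (m<n⇒m/n≡0 (n<1+n b)) ⟩
  c                         ∎
  where open ≤-Reasoning

1≤ceilDivSuc : ∀ a b → 1 ≤ a → 1 ≤ ceilDivSuc a b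
1≤ceilDivSuc a b 1≤a = m≥n⇒m/n>0 (+-monoˡ-≤ b 1≤a)

2[k+1]≡1+[2k+1] : ∀ k → 2 * (k + 1) ≡ suc (2 * k + 1)
2[k+1]≡1+[2k+1] = solve-∀

[1+k]*2m≡m*[2k+2] : ∀ k m → suc k * (2 * m) ≡ m * suc (2 * k + 1)
[1+k]*2m≡m*[2k+2] = solve-∀

k*2m+2m≡m*[2k+2] : ∀ k m → k * (2 * m) + 2 * m ≡ m * suc (2 * k + 1)
k*2m+2m≡m*[2k+2] = solve-∀

module Construction {n k N : ℕ} (C : Fin N → Vertex n) (code : IsCircuitCode n k N C) (1≤k : 1 ≤ k)
  (2[k+1]≤N : 2 * (k + 1) ≤ N) (ρ : ℕ) (N≤2^ρ*2[k+1] : N ≤ 2 ^ ρ * (2 * (k + 1))) where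

  m : ℕ
  m = ceilDivSuc N (2 * k + 1)

  -- Abstract, since unfolding these proofs inside the with-abstractions below is
  -- prohibitively expensive.
  abstract
    1+[2k+1]≤N : suc (2 * k + 1) ≤ N
    1+[2k+1]≤N = subst (_≤ N) (2[k+1]≡1+[2k+1] k) 2[k+1]≤N

    1≤m : 1 ≤ m
    1≤m = 1≤ceilDivSuc N (2 * k + 1) (≤-trans (s≤s z≤n) 1+[2k+1]≤N)

    m≤2^ρ : m ≤ 2 ^ ρ
    m≤2^ρ = ceilDivSuc-least N (2 * k + 1) (2 ^ ρ) (subst (λ B → N ≤ 2 ^ ρ * B) (2[k+1]≡1+[2k+1] k) N≤2^ρ*2[k+1])

    N≤[1+k]*2m : N ≤ suc k * (2 * m)
    N≤[1+k]*2m = subst (N ≤_) (sym ([1+k]*2m≡m*[2k+2] k m)) (≤ceilDivSuc*suc N (2 * k + 1))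

    k*2m≤N+N : k * (2 * m) ≤ N + N
    k*2m≤N+N = begin
      k * (2 * m)          ≤⟨ m≤m+n (k * (2 * m)) (2 * m) ⟩
      k * (2 * m) + 2 * m  ≡⟨ k*2m+2m≡m*[2k+2] k m ⟩
      m * suc (2 * k + 1)  ≤⟨ ceilDivSuc*suc≤ N (2 * k + 1) ⟩
      N + (2 * k + 1)      ≤⟨ +-monoʳ-≤ N (≤-trans (n≤1+n _) 1+[2k+1]≤N) ⟩
      N + N                ∎
      where open ≤-Reasoning

  open GrayCycle ρ m 1≤m m≤2^ρ
  open Schedule N (2 * m) k N≤[1+k]*2m k*2m≤N+N
  open Unrolled C code 2[k+1]≤N

  L : ℕ
  L = N + 2 * m

  vertex : ℕ → Vertex (n + (ρ + 1))
  vertex p = walk (pos p) ++ grayCycle (phase p)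

  vertex-periodic : ∀ p → vertex (p + L) ≡ vertex p
  vertex-periodic p = cong₂ _++_
    (trans (cong walk (pos-periodic p)) (walk-periodic (pos p)))
    (trans (cong grayCycle (phase-periodic p)) (grayCycle-periodic (phase p)))

  oldDist : ℕ → ℕ → ℕ
  oldDist x y = hamming (walk (pos x)) (walk (pos y))

  grayDist : ℕ → ℕ → ℕ
  grayDist x y = hamming (grayCycle (phase x)) (grayCycle (phase y))

  hamming-vertex : ∀ x y → hamming (vertex x) (vertex y) ≡ oldDist x y + grayDist x y
  hamming-vertex x y = hamming-++ (walk (pos x)) (walk (pos y)) (grayCycle (phase x)) (grayCycle (phase y))

  vertex-adjacent : ∀ p → hamming (vertex p) (vertex (suc p)) ≡ 1
  vertex-adjacent p = from-move (Step-Moves (step-Step (state p)))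
    where
    from-move : Moves (state p) (state (suc p)) → hamming (vertex p) (vertex (suc p)) ≡ 1
    from-move (inj₁ (pos′ , phase′)) = trans (hamming-vertex p (suc p)) (cong₂ _+_
      (trans (cong (λ a → hamming (walk (pos p)) (walk a)) pos′) (walk-adjacent (pos p)))
      (trans (cong (λ b → hamming (grayCycle (phase p)) (grayCycle b)) phase′) (hamming-refl (grayCycle (phase p)))))
    from-move (inj₂ (pos′ , phase′)) = trans (hamming-vertex p (suc p)) (cong₂ _+_
      (trans (cong (λ a → hamming (walk (pos p)) (walk a)) pos′) (hamming-refl (walk (pos p))))
      (trans (cong (λ b → hamming (grayCycle (phase p)) (grayCycle b)) phase′) (grayCycle-adjacent (phase p))))

  same-phase-arc : ∀ x d → phase (d + x) ≡ phase x → oldDist x (d + x) ≡ d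
  same-phase-arc x d e with steps-split d x
  ... | α , t , eA , eP , d≡α+t = begin
    hamming (walk (pos x)) (walk (pos (d + x))) ≡⟨ cong (λ a → hamming (walk (pos x)) (walk a)) eA ⟩
    hamming (walk (pos x)) (walk (α + pos x))   ≡⟨ walk-arc (pos x) α α≤1+k ⟩
    α                                           ≡⟨ +-identityʳ α ⟨
    α + 0                                       ≡⟨ cong (α +_) t≡0 ⟨
    α + t                                       ≡⟨ d≡α+t ⟨
    d                                           ∎
    where
    open ≡-Reasoning
    t≡0 : t ≡ 0
    t≡0 = +-cancelʳ-≡ (phase x) t 0 (trans (sym eP) e)
    α≤1+k : α ≤ suc k
    α≤1+k = +-cancelʳ-≤ (pos x) α (suc k) (subst (_≤ suc k + pos x) eA (pos-same-phase x (d + x) (sym e)))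

  -- Three fresh steps would force k steps of C, and two fresh steps never cancel.
  few-switches : ∀ x d α → pos (d + x) ≡ α + pos x → α < k → 1 ≤ grayDist x (d + x) →
                 d ≤ α + grayDist x (d + x)
  few-switches x d α eα α<k 1≤g with steps-split d x
  ... | α′ , t , eA , eP , d≡α′+t = by-switches t eP (trans d≡α′+t (cong (_+ t) α′≡α))
    where
    α′≡α : α′ ≡ α
    α′≡α = +-cancelʳ-≡ (pos x) α′ α (trans (sym eA) eα)
    b = phase x
    g = grayDist x (d + x)
    by-switches : ∀ t → phase (d + x) ≡ t + b → d ≡ α + t → d ≤ α + g
    by-switches 0 eP _ = contradiction
      (trans (cong (λ c → hamming (grayCycle b) (grayCycle c)) eP) (hamming-refl (grayCycle b))) (m<n⇒n≢0 1≤g)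
    by-switches 1 eP d≡α+1 = subst (_≤ α + g) (sym d≡α+1) (+-monoʳ-≤ α 1≤g)
    by-switches 2 eP d≡α+2 = ≤-reflexive (trans d≡α+2 (cong (α +_) (sym g≡2)))
      where
      g≡2 : g ≡ 2
      g≡2 = subst (λ c → hamming (grayCycle b) (grayCycle c) ≡ 2) (sym eP)
        (hamming-two-steps (grayCycle b) (grayCycle (1 + b)) (grayCycle (2 + b))
          (grayCycle-adjacent b) (grayCycle-adjacent (1 + b))
          (subst (λ c → 1 ≤ hamming (grayCycle b) (grayCycle c)) eP 1≤g))
    by-switches (suc (suc (suc t))) eP _ = contradiction (+-cancelʳ-≤ (pos x) k α k+pos≤α+pos) (<⇒≱ α<k)
      where
      k+pos≤α+pos : k + pos x ≤ α + pos x
      k+pos≤α+pos = subst (k + pos x ≤_) eα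
        (pos-three-phases x (d + x) (subst (3 + b ≤_) (sym eP) (+-monoˡ-≤ b (s≤s (s≤s (s≤s z≤n))))))

  -- With α steps of C between p and d + p, the spread of C makes the old distance
  -- min(α, N − α); apply few-switches forward from p or backward from d + p accordingly.
  isometric-switched : ∀ p d → d + p < L →
                       oldDist p (d + p) + grayDist p (d + p) ≤ k → 1 ≤ grayDist p (d + p) →
                       d ≤ oldDist p (d + p) + grayDist p (d + p) ⊎
                       L ∸ d ≤ oldDist p (d + p) + grayDist p (d + p)
  isometric-switched p d d+p<L h≤k 1≤g = from-split (steps-split d p)
    where
    q = d + p
    old = oldDist p q
    g = grayDist p q
    e = L ∸ d

    old<k : old < k
    old<k = <-≤-trans (m<m+n old 1≤g) h≤k

    e+q≡p+L : e + q ≡ p + L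
    e+q≡p+L = begin
      e + (d + p) ≡⟨ +-assoc e d p ⟨
      e + d + p   ≡⟨ cong (_+ p) (m∸n+n≡m (≤-trans (m≤m+n d p) (<⇒≤ d+p<L))) ⟩
      L + p       ≡⟨ +-comm L p ⟩
      p + L       ∎
      where open ≡-Reasoning

    g′≡g : grayDist q (e + q) ≡ g
    g′≡g = begin
      hamming (grayCycle (phase q)) (grayCycle (phase (e + q))) ≡⟨ cong (hamming (grayCycle (phase q))) grayCycle-back ⟩
      hamming (grayCycle (phase q)) (grayCycle (phase p))       ≡⟨ hamming-sym (grayCycle (phase q)) _ ⟩
      g                                                         ∎
      where
      open ≡-Reasoning
      grayCycle-back : grayCycle (phase (e + q)) ≡ grayCycle (phase p)
      grayCycle-back = trans (cong (λ x → grayCycle (phase x)) e+q≡p+L)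
                             (trans (cong grayCycle (phase-periodic p)) (grayCycle-periodic (phase p)))

    from-split : (∃₂ λ α t → pos q ≡ α + pos p × phase q ≡ t + phase p × d ≡ α + t) →
                 d ≤ old + g ⊎ e ≤ old + g
    from-split (α , _ , eA , _ , _) = by-arc (⊓-sel α (N ∸ α))
      where
      α≤N : α ≤ N
      α≤N = +-cancelʳ-≤ (pos p) α N (begin
        α + pos p       ≡⟨ eA ⟨
        pos q           ≤⟨ pos-mono e q ⟩
        pos (e + q)     ≡⟨ cong pos e+q≡p+L ⟩
        pos (p + L)     ≡⟨ pos-periodic p ⟩
        pos p + N       ≡⟨ +-comm (pos p) N ⟩
        N + pos p       ∎)
        where open ≤-Reasoning

      min≡old : α ⊓ (N ∸ α) ≡ old
      min≡old = trans (walk-spread (pos p) α α≤N (subst (λ a → hamming (walk (pos p)) (walk a) < k) eA old<k))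
                      (cong (λ a → hamming (walk (pos p)) (walk a)) (sym eA))

      pos-back : pos (e + q) ≡ N ∸ α + pos q
      pos-back = begin
        pos (e + q)          ≡⟨ cong pos e+q≡p+L ⟩
        pos (p + L)          ≡⟨ pos-periodic p ⟩
        pos p + N            ≡⟨ +-comm (pos p) N ⟩
        N + pos p            ≡⟨ cong (_+ pos p) (m∸n+n≡m α≤N) ⟨
        N ∸ α + α + pos p    ≡⟨ +-assoc (N ∸ α) α (pos p) ⟩
        N ∸ α + (α + pos p)  ≡⟨ cong (N ∸ α +_) eA ⟨
        N ∸ α + pos q        ∎
        where open ≡-Reasoning

      by-arc : α ⊓ (N ∸ α) ≡ α ⊎ α ⊓ (N ∸ α) ≡ N ∸ α → d ≤ old + g ⊎ e ≤ old + g
      by-arc (inj₁ min≡α) = inj₁ (subst (λ a → d ≤ a + g) α≡old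
          (few-switches p d α eA (subst (_< k) (sym α≡old) old<k) 1≤g))
        where
        α≡old : α ≡ old
        α≡old = trans (sym min≡α) min≡old
      by-arc (inj₂ min≡N∸α) = inj₂ (subst₂ (λ a b → e ≤ a + b) N∸α≡old g′≡g
          (few-switches q e (N ∸ α) pos-back (subst (_< k) (sym N∸α≡old) old<k) (subst (1 ≤_) (sym g′≡g) 1≤g)))
        where
        N∸α≡old : N ∸ α ≡ old
        N∸α≡old = trans (sym min≡N∸α) min≡old

  open PeriodicWalk vertex vertex-periodic vertex-adjacent public
    using (Isometric; cycle) renaming (isCircuitCode to periodicWalk-isCircuitCode)

  isometric : Isometric (k + 1)
  isometric p d d+p<L h<k+1 =
    subst (λ h → d ≤ h ⊎ L ∸ d ≤ h) (sym (hamming-vertex p q)) (by-grayDist (grayDist p q) refl)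
    where
    q = d + p
    h≤k : oldDist p q + grayDist p q ≤ k
    h≤k = subst (_≤ k) (hamming-vertex p q) (m<1+n⇒m≤n (subst (hamming (vertex p) (vertex q) <_) (+-comm k 1) h<k+1))
    by-grayDist : ∀ g → grayDist p q ≡ g → d ≤ oldDist p q + grayDist p q ⊎ L ∸ d ≤ oldDist p q + grayDist p q
    by-grayDist zero    g≡0 = inj₁ (subst (_≤ oldDist p q + grayDist p q) (same-phase-arc p d (sym phase≡))
                                     (m≤m+n (oldDist p q) (grayDist p q)))
      where
      phase≡ : phase p ≡ phase q
      phase≡ = grayCycle-injective (phase p) (phase q) (phase<D p (≤-<-trans (m≤n+m p d) d+p<L)) (phase<D q d+p<L)
                 (hamming≡0⇒≡ _ _ g≡0)
    by-grayDist (suc _) g≡  = isometric-switched p d d+p<L h≤k (subst (1 ≤_) (sym g≡) (s≤s z≤n))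

  cycle-isCircuitCode : IsCircuitCode (n + (ρ + 1)) (k + 1) L cycle
  cycle-isCircuitCode = periodicWalk-isCircuitCode 3≤L (subst (2 ≤_) (+-comm 1 k) (s≤s 1≤k)) isometric
    where
    3≤L : 3 ≤ L
    3≤L = ≤-trans (≤-trans (n≤1+n 3) (s≤s (+-monoˡ-≤ 1 (*-monoʳ-≤ 2 1≤k))))
                  (≤-trans 1+[2k+1]≤N (m≤m+n N (2 * m)))

theorem1 : (n k N : ℕ) → 1 ≤ n → 1 ≤ k →
    (C : Fin N → Vertex n) → IsCircuitCode n k N C →
    2 * (k + 1) ≤ N →
    (ρ : ℕ) → IsCeilLog2Ratio N (2 * (k + 1)) ρ →
    Σ (Fin (N + 2 * ceilDivSuc N (2 * k + 1)) → Vertex (n + (ρ + 1)))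
      (λ C′ → IsCircuitCode (n + (ρ + 1)) (k + 1) (N + 2 * ceilDivSuc N (2 * k + 1)) C′)
theorem1 n k N _ 1≤k C code 2[k+1]≤N ρ (N≤2^ρ*2[k+1] , _) = cycle , cycle-isCircuitCode
  where open Construction C code 1≤k 2[k+1]≤N ρ N≤2^ρ*2[k+1]
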